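{- Let $K$ be a $2$-stable diagonal ternary $\mathbb{Z}$-lattice, let $u$ be an odd integer and $l$ an arbitrary integer. Then there is $\nu\in\{0,1,2\}$ such that $u(4n+\nu)+l$ is represented by $K_2=K\otimes\mathbb{Z}_2$ for every integer $n$. If moreover $K$ is $3$-stable and $\gcd(u,6)=1$, then there is $\nu\in\{0,1,2,3,4\}$ such that $u(12n+\nu)+l$ is represented by both $K_2$ and $K_3=K\otimes\mathbb{Z}_3$ for every integer $n$.
   Context: An integer $a$ is represented by a $\mathbb{Z}_p$-lattice $M$ with quadratic map $Q$ if $a=Q(\mathbf{x})$ for some $\mathbf{x}\in M$. A diagonal ternary $\mathbb{Z}$-lattice $K$ is $2$-stable if $K_2$ is unimodular, or the binary lattice $\langle 1,3\rangle$ is represented by $K_2$, or $\langle 1,7\rangle$ is represented by $K_2$. With $\Delta_3$ a non-square unit in $\mathbb{Z}_3$, $K$ is $3$-stable if $\langle 1,-1\rangle$ is represented by $K_3$, or $K_3\cong\langle 1,-\Delta_3\rangle\perp\langle 3\epsilon\rangle$ for some $\epsilon\in\mathbb{Z}_3^\times$. Here $\langle b_1,\dots,b_k\rangle$ denotes a lattice with diagonal Gram matrix with entries $b_1,\dots,b_k$. -}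

module Defs where

open import Data.Nat using (ℕ; suc; _^_)
open import Data.Integer using (ℤ; +_; _+_; _-_; _*_; -_; 0ℤ; 1ℤ)
open import Data.Integer.Divisibility using (_∣_)
open import Data.Fin using (Fin; zero; suc)
open import Data.Product using (Σ; ∃; _×_)
open import Data.Sum using () renaming (_⊎_ to _⊎'_)

infix 4 _≡_[mod_^_]
_≡_[mod_^_] : ℤ → ℤ → ℕ → ℕ → Set
a ≡ b [mod p ^ k ] = (+ (p ^ k)) ∣ (a - b)

-- The p-adic integers ℤ_p, as the inverse limit  lim ℤ/p^k ℤ :
-- a p-adic integer is a coherent sequence of integers (x_k), with
-- x_{k+1} ≡ x_k (mod p^k).  Ring operations on the inverse limit are
-- levelwise, so an identity  P(x) = c  in ℤ_p (P an integer polynomial)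
-- means  P(x_k) ≡ c (mod p^k)  for every level k.

record ℤₚ (p : ℕ) : Set where
  field
    at  : ℕ → ℤ
    coh : ∀ k → at (suc k) ≡ at k [mod p ^ k ]
open ℤₚ public

Vec3ₚ : ℕ → Set
Vec3ₚ p = Fin 3 → ℤₚ p

IsUnitₚ : (p : ℕ) → ℤₚ p → Set
IsUnitₚ p ε = Σ (ℤₚ p) λ δ → ∀ k → at ε k * at δ k ≡ 1ℤ [mod p ^ k ]

IsUnitℤₚ : ℕ → ℤ → Set
IsUnitℤₚ p a = Σ (ℤₚ p) λ δ → ∀ k → a * at δ k ≡ 1ℤ [mod p ^ k ]

-- The diagonal ternary lattice K = ⟨b0,b1,b2⟩ and its localisation
-- K_p = K ⊗ ℤ_p = ℤ_p^3 with Q(x) = Σ b_i x_i^2 and the associated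
-- bilinear form B(x,y) = Σ b_i x_i y_i (so B(x,x) = Q(x)).
-- Qat / Bat are the level-k components.

Qat : ∀ {p} → (Fin 3 → ℤ) → Vec3ₚ p → ℕ → ℤ
Qat b x k = b zero * (at (x zero) k * at (x zero) k)
          + b (suc zero) * (at (x (suc zero)) k * at (x (suc zero)) k)
          + b (suc (suc zero)) * (at (x (suc (suc zero))) k * at (x (suc (suc zero))) k)

Bat : ∀ {p} → (Fin 3 → ℤ) → Vec3ₚ p → Vec3ₚ p → ℕ → ℤ
Bat b x y k = b zero * (at (x zero) k * at (y zero) k)
            + b (suc zero) * (at (x (suc zero)) k * at (y (suc zero)) k)
            + b (suc (suc zero)) * (at (x (suc (suc zero))) k * at (y (suc (suc zero))) k)

Represents : (p : ℕ) → (Fin 3 → ℤ) → ℤ → Set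
Represents p b a = Σ (Vec3ₚ p) λ x → ∀ k → Qat b x k ≡ a [mod p ^ k ]

-- the binary lattice ⟨c1,c2⟩ (c1 c2 ≠ 0) is represented by K_p :
-- there are v, w ∈ K_p with Q(v) = c1, Q(w) = c2, B(v,w) = 0
-- (an isometry ⟨c1,c2⟩ → K_p; injectivity is automatic since ⟨c1,c2⟩
-- is nondegenerate).
RepresentsBinary : (p : ℕ) → (Fin 3 → ℤ) → ℤ → ℤ → Set
RepresentsBinary p b c1 c2 =
  Σ (Vec3ₚ p) λ v → Σ (Vec3ₚ p) λ w → ∀ k →
    (Qat b v k ≡ c1 [mod p ^ k ]) × (Qat b w k ≡ c2 [mod p ^ k ]) × (Bat b v w k ≡ 0ℤ [mod p ^ k ])

-- K_p is unimodular: the discriminant (determinant of the Gram matrix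
-- diag(b0,b1,b2)) is a unit in ℤ_p.
Unimodularₚ : ℕ → (Fin 3 → ℤ) → Set
Unimodularₚ p b = IsUnitℤₚ p (b zero * b (suc zero) * b (suc (suc zero)))

-- K_p ≅ ⟨c0⟩ ⊥ ⟨c1⟩ ⊥ ⟨c2'⟩ where the third entry is 3ε, ε ∈ ℤ_p:
-- there is a basis e0,e1,e2 of K_p = ℤ_p^3 (the matrix M with columns e_j
-- has an inverse F over ℤ_p) with Q(e0)=c0, Q(e1)=c1, Q(e2)=c2*ε,
-- and pairwise B(e_i,e_j)=0.
δℤ : Fin 3 → Fin 3 → ℤ
δℤ zero zero = 1ℤ
δℤ (suc zero) (suc zero) = 1ℤ
δℤ (suc (suc zero)) (suc (suc zero)) = 1ℤ
δℤ _ _ = 0ℤ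

IsBasisₚ : (p : ℕ) → (Fin 3 → Vec3ₚ p) → Set
IsBasisₚ p e = Σ (Fin 3 → Fin 3 → ℤₚ p) λ F → ∀ k i j →
  at (e zero i) k * at (F zero j) k
  + at (e (suc zero) i) k * at (F (suc zero) j) k
  + at (e (suc (suc zero)) i) k * at (F (suc (suc zero)) j) k
  ≡ δℤ i j [mod p ^ k ]

IsometricDiagₚ : (p : ℕ) → (Fin 3 → ℤ) → ℤ → ℤ → ℤ → ℤₚ p → Set
IsometricDiagₚ p b c0 c1 c2 ε =
  Σ (Fin 3 → Vec3ₚ p) λ e → IsBasisₚ p e × (∀ k →
    (Qat b (e zero) k ≡ c0 [mod p ^ k ]) ×
    (Qat b (e (suc zero)) k ≡ c1 [mod p ^ k ]) ×
    (Qat b (e (suc (suc zero))) k ≡ c2 * at ε k [mod p ^ k ]) ×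
    (Bat b (e zero) (e (suc zero)) k ≡ 0ℤ [mod p ^ k ]) ×
    (Bat b (e zero) (e (suc (suc zero))) k ≡ 0ℤ [mod p ^ k ]) ×
    (Bat b (e (suc zero)) (e (suc (suc zero))) k ≡ 0ℤ [mod p ^ k ]))

TwoStable : (Fin 3 → ℤ) → Set
TwoStable b = Unimodularₚ 2 b ⊎' (RepresentsBinary 2 b (+ 1) (+ 3) ⊎' RepresentsBinary 2 b (+ 1) (+ 7))

-- Δ₃ : a fixed non-square unit of ℤ_3 (2 ≡ -1 mod 3 is a non-square);
-- the isometry class of ⟨1,-Δ₃⟩ does not depend on this choice.
Δ₃ : ℤ
Δ₃ = + 2

ThreeStable : (Fin 3 → ℤ) → Set
ThreeStable b = RepresentsBinary 3 b (+ 1) (- (+ 1))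
  ⊎' (Σ (ℤₚ 3) λ ε → IsUnitₚ 3 ε × IsometricDiagₚ 3 b (+ 1) (- Δ₃) (+ 3) ε)

-- Over ℤ₂, if b is odd and c ≡ b (mod 8) then Newton's method lifts y = 1 to a solution of b y² = c;
-- over ℤ₃, every c ≡ 1 (mod 3) is a square.  Hence a 2-stable K₂ represents every integer outside
-- two residue classes 0 and r modulo 4: if ⟨1,3⟩ or ⟨1,7⟩ embeds, every odd integer (r = 2); if all
-- bᵢ are odd, every a ≡ b₀ and, since two of the bᵢ agree modulo 4 and so sum to 2, every a ≡ 2
-- (r = b₀ + 2).  A 3-stable K₃ represents every integer prime to 3, through its binary sublattice
-- ⟨1,-1⟩ or ⟨1,-Δ₃⟩.  As u is odd, the values uν + l (ν = 0, 1, 2) are pairwise incongruent modulo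
-- 4, so by pigeonhole one of them avoids both bad classes.  If moreover 3 ∤ u, the ν ≤ 4 with
-- 3 ∣ uν + l form one class modulo 3, and the remaining ν contain three that are pairwise
-- incongruent modulo 4.
module Submission where

open import Defs
open import Data.Nat using (ℕ; _≤_)
open import Data.Integer using (ℤ; +_; _+_; _*_; _<_; 0ℤ)
open import Data.Integer.Divisibility using (_∣_)
open import Data.Integer.GCD using (gcd; gcd-greatest)
open import Data.Fin using (Fin)
open import Data.Product using (Σ; _×_)
open import Relation.Nullary using (¬_)
open import Relation.Binary.PropositionalEquality using (_≡_)

import Data.Nat as ℕ
import Data.Nat.Properties as ℕ
import Data.Nat.Divisibility as ℕ
open import Data.Nat using (zero; suc; z≤n; s≤s)
open import Data.Integer using (-_; _-_; 1ℤ)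
open import Data.Integer.Properties
  using (pos-*; pos-+; +-comm; *-comm; +-identityʳ; *-identityˡ; *-identityʳ; +-commutativeSemigroup)
open import Data.Integer.Divisibility.Signed
  using ( divides; ∣ᵤ⇒∣; ∣⇒∣ᵤ; _∣?_; ∣-refl; ∣-trans; ∣m∣n⇒∣m+n; ∣m∣n⇒∣m-n; ∣m⇒∣m*n; ∣n⇒∣m*n
        ; *-monoˡ-∣; *-monoʳ-∣; *-cancelˡ-∣)
  renaming (_∣_ to _∣ˢ_)
open import Data.Integer.DivMod using (_%ℕ_; _/ℕ_; a≡a%ℕn+[a/ℕn]*n; n%ℕd<d)
open import Data.Integer.Tactic.RingSolver using (solve; solve-∀)
open import Algebra.Properties.CommutativeSemigroup +-commutativeSemigroup using (xy∙z≈xz∙y)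
open import Data.Fin using (zero; suc)
open import Data.List using (_∷_; [])
open import Data.Product using (_,_; proj₁; proj₂)
open import Data.Sum using (_⊎_; inj₁; inj₂; [_,_]′)
import Data.Sum as Sum
open import Data.Empty using (⊥-elim)
open import Function using (_∘_)
open import Level using (0ℓ)
open import Relation.Nullary using (Dec; yes; no)
open import Relation.Nullary.Decidable as Dec using (_⊎-dec_)
open import Relation.Binary.Bundles using (Setoid)
open import Relation.Binary.PropositionalEquality using (refl; sym; trans; cong; subst; module ≡-Reasoning)
import Relation.Binary.Reasoning.Setoid as SetoidReasoning

infix 4 _≡_mod_
record _≡_mod_ (x y m : ℤ) : Set where
  constructor congruent
  field difference : m ∣ˢ x - y

-- The divisibility comes first so that the equation's left side is already known when a
-- ring-solver macro elaborates the second argument.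
infixl 1 _∣-by_
_∣-by_ : ∀ {m a b} → m ∣ˢ a → a ≡ b → m ∣ˢ b
m∣a ∣-by refl = m∣a

≡mod-refl : ∀ {m x} → x ≡ x mod m
≡mod-refl {m} {x} = congruent (divides 0ℤ (solve (x ∷ m ∷ [])))

≡mod-sym : ∀ {m x y} → x ≡ y mod m → y ≡ x mod m
≡mod-sym {m} {x} {y} (congruent (divides q x-y≡q*m)) = congruent (divides (- q) (begin
  y - x        ≡⟨ solve (x ∷ y ∷ []) ⟩
  - (x - y)    ≡⟨ cong -_ x-y≡q*m ⟩
  - (q * m)    ≡⟨ solve (q ∷ m ∷ []) ⟩
  - q * m      ∎))
  where open ≡-Reasoning

≡mod-trans : ∀ {m x y z} → x ≡ y mod m → y ≡ z mod m → x ≡ z mod m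
≡mod-trans {x = x} {y} {z} (congruent x-y) (congruent y-z) =
  congruent (∣m∣n⇒∣m+n x-y y-z ∣-by solve (x ∷ y ∷ z ∷ []))

≡mod-setoid : ℤ → Setoid 0ℓ 0ℓ
≡mod-setoid m = record
  { Carrier       = ℤ
  ; _≈_           = λ x y → x ≡ y mod m
  ; isEquivalence = record { refl = ≡mod-refl ; sym = ≡mod-sym ; trans = ≡mod-trans }
  }

module ≡mod-Reasoning (m : ℤ) = SetoidReasoning (≡mod-setoid m)

≡mod? : ∀ {m} x y → Dec (x ≡ y mod m)
≡mod? {m} x y = Dec.map′ congruent _≡_mod_.difference (m ∣? x - y)

+-≡mod : ∀ {m x x′ y y′} → x ≡ x′ mod m → y ≡ y′ mod m → x + y ≡ x′ + y′ mod m
+-≡mod {x = x} {x′} {y} {y′} (congruent x-x′) (congruent y-y′) =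
  congruent (∣m∣n⇒∣m+n x-x′ y-y′ ∣-by solve (x ∷ x′ ∷ y ∷ y′ ∷ []))

minus-≡mod : ∀ {m x x′ y y′} → x ≡ x′ mod m → y ≡ y′ mod m → x - y ≡ x′ - y′ mod m
minus-≡mod {x = x} {x′} {y} {y′} (congruent x-x′) (congruent y-y′) =
  congruent (∣m∣n⇒∣m-n x-x′ y-y′ ∣-by solve (x ∷ x′ ∷ y ∷ y′ ∷ []))

*-≡mod : ∀ {m x x′ y y′} → x ≡ x′ mod m → y ≡ y′ mod m → x * y ≡ x′ * y′ mod m
*-≡mod {x = x} {x′} {y} {y′} (congruent x-x′) (congruent y-y′) =
  congruent (∣m∣n⇒∣m+n (∣n⇒∣m*n y x-x′) (∣n⇒∣m*n x′ y-y′) ∣-by solve (x ∷ x′ ∷ y ∷ y′ ∷ []))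

≡mod-scale : ∀ {m x y} k → x ≡ y mod m → k * x ≡ k * y mod k * m
≡mod-scale {x = x} {y} k (congruent x-y) = congruent (*-monoʳ-∣ k x-y ∣-by distrib k x y)
  where
  distrib : ∀ k x y → k * (x - y) ≡ k * x - k * y
  distrib = solve-∀

≡mod-divisor : ∀ {m n x y} → n ∣ˢ m → x ≡ y mod m → x ≡ y mod n
≡mod-divisor n∣m (congruent m∣x-y) = congruent (∣-trans n∣m m∣x-y)

residue : ∀ n .{{_ : ℕ.NonZero n}} x → Σ ℕ λ r → r ℕ.< n × x ≡ + r mod + n
residue n x = x %ℕ n , n%ℕd<d x n , congruent (divides (x /ℕ n) (begin
  x - + (x %ℕ n)                           ≡⟨ cong (_- + (x %ℕ n)) (a≡a%ℕn+[a/ℕn]*n x n) ⟩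
  + (x %ℕ n) + (x /ℕ n) * + n - + (x %ℕ n) ≡⟨ cancel (+ (x %ℕ n)) ((x /ℕ n) * + n) ⟩
  (x /ℕ n) * + n                           ∎))
  where
  open ≡-Reasoning
  cancel : ∀ a b → a + b - a ≡ b
  cancel = solve-∀

parity : ∀ x → x ≡ 0ℤ mod + 2 ⊎ x ≡ 1ℤ mod + 2
parity x with residue 2 x
... | 0 , _ , x≡0 = inj₁ x≡0
... | 1 , _ , x≡1 = inj₂ x≡1
... | suc (suc _) , s≤s (s≤s ()) , _

0≢1-mod-2 : ¬ 0ℤ ≡ 1ℤ mod + 2
0≢1-mod-2 (congruent 2∣-1) with ℕ.∣1⇒≡1 (∣⇒∣ᵤ 2∣-1)
... | ()

split-class : ∀ {m x c} → x ≡ c mod m → x ≡ c mod (+ 2 * m) ⊎ x ≡ c + m mod (+ 2 * m)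
split-class {m} {x} {c} (congruent (divides q x-c≡q*m)) with parity q
... | inj₁ (congruent 2∣q) = inj₁ (congruent (*-monoˡ-∣ m 2∣q ∣-by (begin
  (q - 0ℤ) * m ≡⟨ solve (q ∷ m ∷ []) ⟩
  q * m        ≡⟨ sym x-c≡q*m ⟩
  x - c        ∎)))
  where open ≡-Reasoning
... | inj₂ (congruent 2∣q-1) = inj₂ (congruent (*-monoˡ-∣ m 2∣q-1 ∣-by (begin
  (q - 1ℤ) * m ≡⟨ solve (q ∷ m ∷ []) ⟩
  q * m - m    ≡⟨ cong (_- m) (sym x-c≡q*m) ⟩
  x - c - m    ≡⟨ solve (x ∷ c ∷ m ∷ []) ⟩
  x - (c + m)  ∎)))
  where open ≡-Reasoning

infix 4 _≡_∨_mod_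
_≡_∨_mod_ : ℤ → ℤ → ℤ → ℤ → Set
x ≡ c₀ ∨ c₁ mod m = x ≡ c₀ mod m ⊎ x ≡ c₁ mod m

≡∨mod? : ∀ {m} v c₀ c₁ → Dec (v ≡ c₀ ∨ c₁ mod m)
≡∨mod? v c₀ c₁ = ≡mod? v c₀ ⊎-dec ≡mod? v c₁

∉-classes-resp : ∀ {m c₀ c₁ a a′} → a ≡ a′ mod m → ¬ a′ ≡ c₀ ∨ c₁ mod m → ¬ a ≡ c₀ ∨ c₁ mod m
∉-classes-resp a≡a′ a′∉ = a′∉ ∘ Sum.map (≡mod-trans (≡mod-sym a≡a′)) (≡mod-trans (≡mod-sym a≡a′))

same-class : ∀ {m x y c} → x ≡ c mod m → y ≡ c mod m → y ≡ x mod m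
same-class x≡c y≡c = ≡mod-trans y≡c (≡mod-sym x≡c)

pigeonhole : ∀ {m c₀ c₁ x y z} →
  x ≡ c₀ ∨ c₁ mod m → y ≡ c₀ ∨ c₁ mod m → z ≡ c₀ ∨ c₁ mod m →
  y ≡ x mod m ⊎ z ≡ x mod m ⊎ z ≡ y mod m
pigeonhole (inj₁ x≡c) (inj₁ y≡c) _          = inj₁ (same-class x≡c y≡c)
pigeonhole (inj₂ x≡c) (inj₂ y≡c) _          = inj₁ (same-class x≡c y≡c)
pigeonhole (inj₁ x≡c) (inj₂ _)   (inj₁ z≡c) = inj₂ (inj₁ (same-class x≡c z≡c))
pigeonhole (inj₂ x≡c) (inj₁ _)   (inj₂ z≡c) = inj₂ (inj₁ (same-class x≡c z≡c))
pigeonhole (inj₁ _)   (inj₂ y≡c) (inj₂ z≡c) = inj₂ (inj₂ (same-class y≡c z≡c))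
pigeonhole (inj₂ _)   (inj₁ y≡c) (inj₁ z≡c) = inj₂ (inj₂ (same-class y≡c z≡c))

avoid-two-classes : ∀ {m} c₀ c₁ {x y z} → ¬ y ≡ x mod m → ¬ z ≡ x mod m → ¬ z ≡ y mod m →
  ¬ x ≡ c₀ ∨ c₁ mod m ⊎ ¬ y ≡ c₀ ∨ c₁ mod m ⊎ ¬ z ≡ c₀ ∨ c₁ mod m
avoid-two-classes c₀ c₁ {x} {y} {z} y≢x z≢x z≢y with ≡∨mod? x c₀ c₁ | ≡∨mod? y c₀ c₁ | ≡∨mod? z c₀ c₁
... | no x∉  | _      | _      = inj₁ x∉
... | yes _  | no y∉  | _      = inj₂ (inj₁ y∉)
... | yes _  | yes _  | no z∉  = inj₂ (inj₂ z∉)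
... | yes x∈ | yes y∈ | yes z∈ = ⊥-elim ([ y≢x , [ z≢x , z≢y ]′ ]′ (pigeonhole x∈ y∈ z∈))

odd-factors : ∀ x y → x * y ≡ 1ℤ mod + 2 → x ≡ 1ℤ mod + 2 × y ≡ 1ℤ mod + 2
odd-factors x y xy≡1 = odd-factor x y xy≡1 , odd-factor y x (subst (_≡ 1ℤ mod + 2) (*-comm x y) xy≡1)
  where
  odd-factor : ∀ x y → x * y ≡ 1ℤ mod + 2 → x ≡ 1ℤ mod + 2
  odd-factor x y xy≡1 with parity x
  ... | inj₁ x≡0 = ⊥-elim (0≢1-mod-2 (≡mod-trans (≡mod-sym (*-≡mod x≡0 (≡mod-refl {x = y}))) xy≡1))
  ... | inj₂ x≡1 = x≡1

∣-from-consecutive-multiples : ∀ {m} k u → m ∣ˢ (k + 1ℤ) * u → m ∣ˢ k * u → m ∣ˢ u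
∣-from-consecutive-multiples k u m∣[k+1]u m∣ku = ∣m∣n⇒∣m-n m∣[k+1]u m∣ku ∣-by solve (k ∷ u ∷ [])

infixr 8 _^ℤ_
_^ℤ_ : ℕ → ℕ → ℤ
p ^ℤ k = + (p ℕ.^ k)

^ℤ-suc : ∀ p k → p ^ℤ suc k ≡ + p * p ^ℤ k
^ℤ-suc p k = pos-* p (p ℕ.^ k)

≡[mod]⇒≡mod : ∀ {n x y} → + n ∣ x - y → x ≡ y mod + n
≡[mod]⇒≡mod x≡y = congruent (∣ᵤ⇒∣ x≡y)

≡mod⇒≡[mod] : ∀ {n x y} → x ≡ y mod + n → + n ∣ x - y
≡mod⇒≡[mod] (congruent x-y) = ∣⇒∣ᵤ x-y

mkℤₚ : ∀ {p} (x : ℕ → ℤ) → (∀ k → x (suc k) ≡ x k mod p ^ℤ k) → ℤₚ p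
mkℤₚ x x-coh = record { at = x ; coh = λ k → ≡mod⇒≡[mod] (x-coh k) }

coherence : ∀ {p} (x : ℤₚ p) k → at x (suc k) ≡ at x k mod p ^ℤ k
coherence {p} x k = ≡[mod]⇒≡mod {p ℕ.^ k} {at x (suc k)} {at x k} (coh x k)

const : ∀ {p} → ℤ → ℤₚ p
const z = mkℤₚ (λ _ → z) (λ _ → ≡mod-refl)

infixl 6 _+ₚ_
_+ₚ_ : ∀ {p} → ℤₚ p → ℤₚ p → ℤₚ p
x +ₚ y = mkℤₚ (λ k → at x k + at y k) (λ k → +-≡mod (coherence x k) (coherence y k))

infixl 7 _*ₚ_
_*ₚ_ : ∀ {p} → ℤₚ p → ℤₚ p → ℤₚ p
x *ₚ y = mkℤₚ (λ k → at x k * at y k) (λ k → *-≡mod (coherence x k) (coherence y k))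

record Represents₁ (p : ℕ) (c a : ℤ) : Set where
  constructor rep₁
  field
    x   : ℤₚ p
    eqn : ∀ k → c * (at x k * at x k) ≡ a mod p ^ℤ k

record Represents₂ (p : ℕ) (c₁ c₂ a : ℤ) : Set where
  constructor rep₂
  field
    x y : ℤₚ p
    eqn : ∀ k → c₁ * (at x k * at x k) + c₂ * (at y k * at y k) ≡ a mod p ^ℤ k

⟨_,_,_⟩ : ∀ {A : Set} → A → A → A → Fin 3 → A
⟨ x₀ , x₁ , x₂ ⟩ zero             = x₀
⟨ x₀ , x₁ , x₂ ⟩ (suc zero)       = x₁
⟨ x₀ , x₁ , x₂ ⟩ (suc (suc zero)) = x₂

Represents₂-swap : ∀ {p c₁ c₂ a} → Represents₂ p c₁ c₂ a → Represents₂ p c₂ c₁ a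
Represents₂-swap {p} {c₁} {c₂} {a} (rep₂ x y rep) = rep₂ y x λ k → let open ≡mod-Reasoning (p ^ℤ k) in begin
  c₂ * (at y k * at y k) + c₁ * (at x k * at x k) ≡⟨ +-comm (c₂ * (at y k * at y k)) _ ⟩
  c₁ * (at x k * at x k) + c₂ * (at y k * at y k) ≈⟨ rep k ⟩
  a                                               ∎

Represents₁⇒Represents₂ : ∀ {p c₁ c₂ a} t → Represents₁ p c₁ (a - c₂ * (t * t)) → Represents₂ p c₁ c₂ a
Represents₁⇒Represents₂ {p} {c₁} {c₂} {a} t (rep₁ x rep) = rep₂ x (const t) λ k →
  let open ≡mod-Reasoning (p ^ℤ k) in begin
  c₁ * (at x k * at x k) + c₂ * (t * t) ≈⟨ +-≡mod (rep k) ≡mod-refl ⟩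
  a - c₂ * (t * t) + c₂ * (t * t)       ≡⟨ solve (a ∷ c₂ ∷ t ∷ []) ⟩
  a                                     ∎

Represents₂⇒Represents : ∀ {p c₀ c₁ a} c₂ t → Represents₂ p c₀ c₁ (a - c₂ * (t * t)) →
  Represents p ⟨ c₀ , c₁ , c₂ ⟩ a
Represents₂⇒Represents {p} {c₀} {c₁} {a} c₂ t (rep₂ x y rep) = ⟨ x , y , const t ⟩ , λ k →
  ≡mod⇒≡[mod] (let open ≡mod-Reasoning (p ^ℤ k) in begin
  c₀ * (at x k * at x k) + c₁ * (at y k * at y k) + c₂ * (t * t) ≈⟨ +-≡mod (rep k) ≡mod-refl ⟩
  a - c₂ * (t * t) + c₂ * (t * t)                                ≡⟨ solve (a ∷ c₂ ∷ t ∷ []) ⟩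
  a                                                              ∎)

Represents-swap₁₂ : ∀ {p a} c₀ c₁ c₂ → Represents p ⟨ c₀ , c₂ , c₁ ⟩ a → Represents p ⟨ c₀ , c₁ , c₂ ⟩ a
Represents-swap₁₂ {p} {a} c₀ c₁ c₂ (x , rep) = ⟨ x₀ , x₂ , x₁ ⟩ , λ k →
  subst (_≡ a [mod p ^ k ])
    (xy∙z≈xz∙y (c₀ * (at x₀ k * at x₀ k)) (c₂ * (at x₁ k * at x₁ k)) (c₁ * (at x₂ k * at x₂ k)))
    (rep k)
  where
  x₀ = x zero
  x₁ = x (suc zero)
  x₂ = x (suc (suc zero))

Qat-combination : ∀ {p} b (α β : ℤₚ p) (v w : Vec3ₚ p) k →
  Qat b (λ i → α *ₚ v i +ₚ β *ₚ w i) k ≡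
  Qat b v k * (at α k * at α k) + Bat b v w k * (+ 2 * at α k * at β k) + Qat b w k * (at β k * at β k)
Qat-combination b α β v w k = expand (b zero) (b (suc zero)) (b (suc (suc zero))) (at α k) (at β k)
  (at (v zero) k) (at (v (suc zero)) k) (at (v (suc (suc zero))) k)
  (at (w zero) k) (at (w (suc zero)) k) (at (w (suc (suc zero))) k)
  where
  expand : ∀ b₀ b₁ b₂ α β v₀ v₁ v₂ w₀ w₁ w₂ →
    b₀ * ((α * v₀ + β * w₀) * (α * v₀ + β * w₀)) + b₁ * ((α * v₁ + β * w₁) * (α * v₁ + β * w₁))
      + b₂ * ((α * v₂ + β * w₂) * (α * v₂ + β * w₂))
    ≡ (b₀ * (v₀ * v₀) + b₁ * (v₁ * v₁) + b₂ * (v₂ * v₂)) * (α * α)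
      + (b₀ * (v₀ * w₀) + b₁ * (v₁ * w₁) + b₂ * (v₂ * w₂)) * (+ 2 * α * β)
      + (b₀ * (w₀ * w₀) + b₁ * (w₁ * w₁) + b₂ * (w₂ * w₂)) * (β * β)
  expand = solve-∀

RepresentsBinary⇒Represents : ∀ {p b c₁ c₂ a} → RepresentsBinary p b c₁ c₂ → Represents₂ p c₁ c₂ a →
  Represents p b a
RepresentsBinary⇒Represents {p} {b} {c₁} {c₂} {a} (v , w , vw) (rep₂ α β rep) = z , λ k →
  ≡mod⇒≡[mod] (let open ≡mod-Reasoning (p ^ℤ k) in begin
  Qat b z k                                    ≡⟨ Qat-combination b α β v w k ⟩
  Qat b v k * αα k + Bat b v w k * (+ 2 * at α k * at β k) + Qat b w k * ββ k
    ≈⟨ +-≡mod (+-≡mod (*-≡mod (Qv≡c₁ k) ≡mod-refl) (*-≡mod (Bvw≡0 k) ≡mod-refl))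
              (*-≡mod (Qw≡c₂ k) ≡mod-refl) ⟩
  c₁ * αα k + 0ℤ + c₂ * ββ k                   ≡⟨ cong (_+ c₂ * ββ k) (+-identityʳ (c₁ * αα k)) ⟩
  c₁ * αα k + c₂ * ββ k                        ≈⟨ rep k ⟩
  a                                            ∎)
  where
  z : Vec3ₚ p
  z i = α *ₚ v i +ₚ β *ₚ w i
  αα ββ : ℕ → ℤ
  αα k = at α k * at α k
  ββ k = at β k * at β k
  Qv≡c₁ : ∀ k → Qat b v k ≡ c₁ mod p ^ℤ k
  Qv≡c₁ k = ≡[mod]⇒≡mod (proj₁ (vw k))
  Qw≡c₂ : ∀ k → Qat b w k ≡ c₂ mod p ^ℤ k
  Qw≡c₂ k = ≡[mod]⇒≡mod (proj₁ (proj₂ (vw k)))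
  Bvw≡0 : ∀ k → Bat b v w k ≡ 0ℤ mod p ^ℤ k
  Bvw≡0 k = ≡[mod]⇒≡mod (proj₂ (proj₂ (vw k)))

-- Hensel lifting

-- The step gains a factor 2 because 1 + b y is even.
newton-step₂ : ∀ β c t e P → let b = + 2 * β + 1ℤ in
  b * ((+ 2 * t + 1ℤ) * (+ 2 * t + 1ℤ)) - c ≡ e * + 8 * P →
  b * ((+ 2 * (t + + 2 * P * e) + 1ℤ) * (+ 2 * (t + + 2 * P * e) + 1ℤ)) - c
    ≡ (e * (+ 2 * β * t + β + t + 1ℤ) + P * b * e * e) * + 8 * (+ 2 * P)
newton-step₂ β c t e P error =
  let b = + 2 * β + 1ℤ ; y = + 2 * t + 1ℤ ; y′ = + 2 * (t + + 2 * P * e) + 1ℤ in begin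
  b * (y′ * y′) - c                                                    ≡⟨ solve (β ∷ c ∷ t ∷ e ∷ P ∷ []) ⟩
  (b * (y * y) - c) + e * + 8 * P * (b * y) + + 16 * P * P * b * e * e
    ≡⟨ cong (λ d → d + e * + 8 * P * (b * y) + + 16 * P * P * b * e * e) error ⟩
  e * + 8 * P + e * + 8 * P * (b * y) + + 16 * P * P * b * e * e       ≡⟨ solve (β ∷ t ∷ e ∷ P ∷ []) ⟩
  (e * (+ 2 * β * t + β + t + 1ℤ) + P * b * e * e) * + 8 * (+ 2 * P)   ∎
  where open ≡-Reasoning

module Hensel₂ (β c e₀ : ℤ) (b-c : + 2 * β + 1ℤ - c ≡ e₀ * + 8) where
  b : ℤ
  b = + 2 * β + 1ℤ

  t e : ℕ → ℤ
  t zero    = 0ℤ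
  t (suc k) = t k + + 2 * 2 ^ℤ k * e k
  e zero    = e₀
  e (suc k) = e k * (+ 2 * β * t k + β + t k + 1ℤ) + 2 ^ℤ k * b * e k * e k

  y : ℕ → ℤ
  y k = + 2 * t k + 1ℤ

  error : ∀ k → b * (y k * y k) - c ≡ e k * + 8 * 2 ^ℤ k
  error zero    = begin
    (+ 2 * β + 1ℤ) * ((+ 2 * 0ℤ + 1ℤ) * (+ 2 * 0ℤ + 1ℤ)) - c ≡⟨ solve (β ∷ c ∷ []) ⟩
    + 2 * β + 1ℤ - c                                         ≡⟨ b-c ⟩
    e₀ * + 8                                                 ≡⟨ solve (e₀ ∷ []) ⟩
    e₀ * + 8 * + 1                                           ∎
    where open ≡-Reasoning
  error (suc k) = trans (newton-step₂ β c (t k) (e k) (2 ^ℤ k) (error k))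
                        (cong (e (suc k) * + 8 *_) (sym (^ℤ-suc 2 k)))

  y-coh : ∀ k → y (suc k) ≡ y k mod 2 ^ℤ k
  y-coh k = congruent (divides (+ 4 * e k) (step (t k) (e k) (2 ^ℤ k)))
    where
    step : ∀ t e P → + 2 * (t + + 2 * P * e) + 1ℤ - (+ 2 * t + 1ℤ) ≡ + 4 * e * P
    step = solve-∀

  solution : Represents₁ 2 b c
  solution = rep₁ (mkℤₚ y y-coh) λ k → congruent (divides (e k * + 8) (error k))

hensel₂ : ∀ {b c} → b ≡ 1ℤ mod + 2 → b ≡ c mod + 8 → Represents₁ 2 b c
hensel₂ {b} {c} (congruent (divides β b-1)) (congruent (divides e₀ b-c)) =
  subst (λ b′ → Represents₁ 2 b′ c) (sym b≡2β+1)
    (Hensel₂.solution β c e₀ (subst (λ b′ → b′ - c ≡ e₀ * + 8) b≡2β+1 b-c))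
  where
  b≡2β+1 : b ≡ + 2 * β + 1ℤ
  b≡2β+1 = begin
    b              ≡⟨ solve (b ∷ []) ⟩
    (b - 1ℤ) + 1ℤ  ≡⟨ cong (_+ 1ℤ) b-1 ⟩
    β * + 2 + 1ℤ   ≡⟨ solve (β ∷ []) ⟩
    + 2 * β + 1ℤ   ∎
    where open ≡-Reasoning

-- The step gains a factor 3 because 1 + 2y ≡ 0 (mod 3) for y ≡ 1.
newton-step₃ : ∀ c t e P → (+ 3 * t + 1ℤ) * (+ 3 * t + 1ℤ) - c ≡ e * + 3 * P →
  (+ 3 * (t + P * e) + 1ℤ) * (+ 3 * (t + P * e) + 1ℤ) - c ≡ (e * (1ℤ + + 2 * t) + P * e * e) * + 3 * (+ 3 * P)
newton-step₃ c t e P error = let y = + 3 * t + 1ℤ ; y′ = + 3 * (t + P * e) + 1ℤ in begin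
  y′ * y′ - c                                          ≡⟨ solve (c ∷ t ∷ e ∷ P ∷ []) ⟩
  (y * y - c) + + 6 * P * e * y + + 9 * P * P * e * e
    ≡⟨ cong (λ d → d + + 6 * P * e * y + + 9 * P * P * e * e) error ⟩
  e * + 3 * P + + 6 * P * e * y + + 9 * P * P * e * e  ≡⟨ solve (t ∷ e ∷ P ∷ []) ⟩
  (e * (1ℤ + + 2 * t) + P * e * e) * + 3 * (+ 3 * P)   ∎
  where open ≡-Reasoning

module Hensel₃ (c e₀ : ℤ) (1-c : 1ℤ - c ≡ e₀ * + 3) where
  t e : ℕ → ℤ
  t zero    = 0ℤ
  t (suc k) = t k + 3 ^ℤ k * e k
  e zero    = e₀
  e (suc k) = e k * (1ℤ + + 2 * t k) + 3 ^ℤ k * e k * e k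

  y : ℕ → ℤ
  y k = + 3 * t k + 1ℤ

  error : ∀ k → y k * y k - c ≡ e k * + 3 * 3 ^ℤ k
  error zero    = begin
    (+ 3 * 0ℤ + 1ℤ) * (+ 3 * 0ℤ + 1ℤ) - c ≡⟨ solve (c ∷ []) ⟩
    1ℤ - c                               ≡⟨ 1-c ⟩
    e₀ * + 3                             ≡⟨ solve (e₀ ∷ []) ⟩
    e₀ * + 3 * + 1                       ∎
    where open ≡-Reasoning
  error (suc k) = trans (newton-step₃ c (t k) (e k) (3 ^ℤ k) (error k))
                        (cong (e (suc k) * + 3 *_) (sym (^ℤ-suc 3 k)))

  y-coh : ∀ k → y (suc k) ≡ y k mod 3 ^ℤ k
  y-coh k = congruent (divides (+ 3 * e k) (step (t k) (e k) (3 ^ℤ k)))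
    where
    step : ∀ t e P → + 3 * (t + P * e) + 1ℤ - (+ 3 * t + 1ℤ) ≡ + 3 * e * P
    step = solve-∀

  solution : Represents₁ 3 1ℤ c
  solution = rep₁ (mkℤₚ y y-coh) λ k →
    congruent (divides (e k * + 3) (trans (cong (_- c) (*-identityˡ (y k * y k))) (error k)))

hensel₃ : ∀ {c} → 1ℤ ≡ c mod + 3 → Represents₁ 3 1ℤ c
hensel₃ {c} (congruent (divides e₀ 1-c)) = Hensel₃.solution c e₀ 1-c

-- Representations over ℤ₂

odd-binary-2adic : ∀ {c₁ c₂ a} → c₁ ≡ 1ℤ mod + 2 → c₂ ≡ 1ℤ mod + 2 → a ≡ c₁ mod + 4 → Represents₂ 2 c₁ c₂ a
odd-binary-2adic {c₁} {c₂} {a} c₁-odd c₂-odd a≡c₁ with split-class a≡c₁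
... | inj₁ a≡c₁[8] = Represents₁⇒Represents₂ 0ℤ (hensel₂ c₁-odd (≡mod-sym (begin
  a - c₂ * (0ℤ * 0ℤ)  ≡⟨ solve (a ∷ c₂ ∷ []) ⟩
  a                   ≈⟨ a≡c₁[8] ⟩
  c₁                  ∎)))
  where open ≡mod-Reasoning (+ 8)
... | inj₂ a≡c₁+4[8] = Represents₁⇒Represents₂ (+ 2) (hensel₂ c₁-odd (≡mod-sym (begin
  a - c₂ * (+ 2 * + 2)
    ≈⟨ minus-≡mod a≡c₁+4[8] (subst (_≡ + 4 mod + 8) (*-comm (+ 4) c₂) (≡mod-scale (+ 4) c₂-odd)) ⟩
  c₁ + + 4 - + 4       ≡⟨ solve (c₁ ∷ []) ⟩
  c₁                   ∎)))
  where open ≡mod-Reasoning (+ 8)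

⟨1,c⟩-represents-odd : ∀ {c a} → c ≡ + 3 mod + 4 → a ≡ 1ℤ mod + 2 → Represents₂ 2 1ℤ c a
⟨1,c⟩-represents-odd {c} c≡3 a-odd =
  [ odd-binary-2adic ≡mod-refl c-odd
  , (λ a≡3 → Represents₂-swap (odd-binary-2adic c-odd ≡mod-refl (≡mod-trans a≡3 (≡mod-sym c≡3))))
  ]′ (split-class a-odd)
  where
  c-odd : c ≡ 1ℤ mod + 2
  c-odd = ≡mod-trans (≡mod-divisor (divides (+ 2) refl) c≡3) (congruent (divides 1ℤ refl))

⟨1,c⟩-sublattice-2adic : ∀ {b c} → RepresentsBinary 2 b 1ℤ c → c ≡ + 3 mod + 4 →
  ∀ a → ¬ a ≡ 0ℤ ∨ + 2 mod + 4 → Represents 2 b a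
⟨1,c⟩-sublattice-2adic {b} K⊇⟨1,c⟩ c≡3 a a∉ with parity a
... | inj₂ a-odd  = RepresentsBinary⇒Represents {b = b} K⊇⟨1,c⟩ (⟨1,c⟩-represents-odd c≡3 a-odd)
... | inj₁ a-even = ⊥-elim (a∉ (split-class a-even))

≡2-minus-odd : ∀ {a c c′} → c ≡ 1ℤ mod + 2 → c′ ≡ c mod + 4 → a ≡ + 2 mod + 4 → a - c′ * (1ℤ * 1ℤ) ≡ c mod + 4
≡2-minus-odd {a} {c} {c′} c-odd c′≡c a≡2 = begin
  a - c′ * (1ℤ * 1ℤ) ≈⟨ minus-≡mod a≡2 (subst (_≡ c mod + 4) (sym (*-identityʳ c′)) c′≡c) ⟩
  + 2 - c            ≈⟨ minus-≡mod (≡mod-sym (≡mod-scale (+ 2) c-odd)) ≡mod-refl ⟩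
  + 2 * c - c        ≡⟨ solve (c ∷ []) ⟩
  c                  ∎
  where open ≡mod-Reasoning (+ 4)

odd-diagonal-≡2 : ∀ b₀ b₁ b₂ {a} → b₀ ≡ 1ℤ mod + 2 → b₁ ≡ 1ℤ mod + 2 → b₂ ≡ 1ℤ mod + 2 →
  a ≡ + 2 mod + 4 → Represents 2 ⟨ b₀ , b₁ , b₂ ⟩ a
odd-diagonal-≡2 b₀ b₁ b₂ b₀-odd b₁-odd b₂-odd a≡2
  with pigeonhole (split-class b₀-odd) (split-class b₁-odd) (split-class b₂-odd)
... | inj₁ b₁≡b₀ = Represents-swap₁₂ b₀ b₁ b₂
  (Represents₂⇒Represents b₁ 1ℤ (odd-binary-2adic b₀-odd b₂-odd (≡2-minus-odd b₀-odd b₁≡b₀ a≡2)))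
... | inj₂ (inj₁ b₂≡b₀) =
  Represents₂⇒Represents b₂ 1ℤ (odd-binary-2adic b₀-odd b₁-odd (≡2-minus-odd b₀-odd b₂≡b₀ a≡2))
... | inj₂ (inj₂ b₂≡b₁) =
  Represents₂⇒Represents b₂ 1ℤ (Represents₂-swap (odd-binary-2adic b₁-odd b₀-odd (≡2-minus-odd b₁-odd b₂≡b₁ a≡2)))

odd-diagonal-≡b₀ : ∀ b₀ b₁ b₂ {a} → b₀ ≡ 1ℤ mod + 2 → b₁ ≡ 1ℤ mod + 2 →
  a ≡ b₀ mod + 4 → Represents 2 ⟨ b₀ , b₁ , b₂ ⟩ a
odd-diagonal-≡b₀ b₀ b₁ b₂ {a} b₀-odd b₁-odd a≡b₀ =
  Represents₂⇒Represents b₂ 0ℤ (odd-binary-2adic b₀-odd b₁-odd (begin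
    a - b₂ * (0ℤ * 0ℤ) ≡⟨ solve (a ∷ b₂ ∷ []) ⟩
    a                  ≈⟨ a≡b₀ ⟩
    b₀                 ∎))
  where open ≡mod-Reasoning (+ 4)

odd-diagonal-2adic : ∀ b₀ b₁ b₂ {a} → b₀ ≡ 1ℤ mod + 2 → b₁ ≡ 1ℤ mod + 2 → b₂ ≡ 1ℤ mod + 2 →
  ¬ a ≡ 0ℤ ∨ b₀ + + 2 mod + 4 → Represents 2 ⟨ b₀ , b₁ , b₂ ⟩ a
odd-diagonal-2adic b₀ b₁ b₂ {a} b₀-odd b₁-odd b₂-odd a∉ with parity a
... | inj₁ a-even =
  [ (λ a≡0 → ⊥-elim (a∉ (inj₁ a≡0))) , odd-diagonal-≡2 b₀ b₁ b₂ b₀-odd b₁-odd b₂-odd ]′ (split-class a-even)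
... | inj₂ a-odd =
  [ odd-diagonal-≡b₀ b₀ b₁ b₂ b₀-odd b₁-odd , (λ a≡b₀+2 → ⊥-elim (a∉ (inj₂ a≡b₀+2))) ]′
    (split-class (≡mod-trans a-odd (≡mod-sym b₀-odd)))

unimodular-odd : ∀ {b} → Unimodularₚ 2 b →
  b zero ≡ 1ℤ mod + 2 × b (suc zero) ≡ 1ℤ mod + 2 × b (suc (suc zero)) ≡ 1ℤ mod + 2
unimodular-odd {b} (δ , unit) =
  let b₀b₁b₂-odd , _   = odd-factors (b₀ * b₁ * b₂) (at δ 1) (≡[mod]⇒≡mod (unit 1))
      b₀b₁-odd , b₂-odd = odd-factors (b₀ * b₁) b₂ b₀b₁b₂-odd
      b₀-odd , b₁-odd   = odd-factors b₀ b₁ b₀b₁-odd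
  in b₀-odd , b₁-odd , b₂-odd
  where
  b₀ = b zero
  b₁ = b (suc zero)
  b₂ = b (suc (suc zero))

TwoStable⇒represents : ∀ b → TwoStable b → Σ ℤ λ r → ∀ a → ¬ a ≡ 0ℤ ∨ r mod + 4 → Represents 2 b a
TwoStable⇒represents b (inj₁ K-unimodular) =
  let b₀-odd , b₁-odd , b₂-odd = unimodular-odd {b} K-unimodular
  in b zero + + 2 , λ a → odd-diagonal-2adic (b zero) (b (suc zero)) (b (suc (suc zero))) b₀-odd b₁-odd b₂-odd
TwoStable⇒represents b (inj₂ (inj₁ K⊇⟨1,3⟩)) = + 2 , ⟨1,c⟩-sublattice-2adic {b} K⊇⟨1,3⟩ ≡mod-refl
TwoStable⇒represents b (inj₂ (inj₂ K⊇⟨1,7⟩)) = + 2 , ⟨1,c⟩-sublattice-2adic {b} K⊇⟨1,7⟩ (congruent (divides 1ℤ refl))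

-- Representations over ℤ₃

half₃ : ℕ → ℤ
half₃ zero    = 1ℤ
half₃ (suc k) = + 3 * half₃ k - 1ℤ

2*half₃-1 : ∀ k → + 2 * half₃ k - 1ℤ ≡ 3 ^ℤ k
2*half₃-1 zero    = refl
2*half₃-1 (suc k) = begin
  + 2 * (+ 3 * half₃ k - 1ℤ) - 1ℤ ≡⟨ identity (half₃ k) ⟩
  + 3 * (+ 2 * half₃ k - 1ℤ)      ≡⟨ cong (+ 3 *_) (2*half₃-1 k) ⟩
  + 3 * 3 ^ℤ k                    ≡⟨ sym (^ℤ-suc 3 k) ⟩
  3 ^ℤ suc k                      ∎
  where
  open ≡-Reasoning
  identity : ∀ h → + 2 * (+ 3 * h - 1ℤ) - 1ℤ ≡ + 3 * (+ 2 * h - 1ℤ)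
  identity = solve-∀

½ : ℤₚ 3
½ = mkℤₚ half₃ λ k → congruent (divides 1ℤ (begin
  + 3 * half₃ k - 1ℤ - half₃ k ≡⟨ identity (half₃ k) ⟩
  + 2 * half₃ k - 1ℤ           ≡⟨ 2*half₃-1 k ⟩
  3 ^ℤ k                       ≡⟨ sym (*-identityˡ (3 ^ℤ k)) ⟩
  1ℤ * 3 ^ℤ k                  ∎))
  where
  open ≡-Reasoning
  identity : ∀ h → + 3 * h - 1ℤ - h ≡ + 2 * h - 1ℤ
  identity = solve-∀

-- x = (a + 1)/2 and y = (a - 1)/2 satisfy x² - y² = a.
hyperbolic-represents : ∀ a → Represents₂ 3 1ℤ (- 1ℤ) a
hyperbolic-represents a = rep₂ (const (a + 1ℤ) *ₚ ½) (const (a - 1ℤ) *ₚ ½) λ k →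
  congruent (divides (a * (+ 2 * half₃ k + 1ℤ)) (begin
    1ℤ * ((a + 1ℤ) * half₃ k * ((a + 1ℤ) * half₃ k)) + - 1ℤ * ((a - 1ℤ) * half₃ k * ((a - 1ℤ) * half₃ k)) - a
                                                    ≡⟨ identity a (half₃ k) ⟩
    a * (+ 2 * half₃ k + 1ℤ) * (+ 2 * half₃ k - 1ℤ) ≡⟨ cong (a * (+ 2 * half₃ k + 1ℤ) *_) (2*half₃-1 k) ⟩
    a * (+ 2 * half₃ k + 1ℤ) * 3 ^ℤ k               ∎))
  where
  open ≡-Reasoning
  identity : ∀ a h → 1ℤ * ((a + 1ℤ) * h * ((a + 1ℤ) * h)) + - 1ℤ * ((a - 1ℤ) * h * ((a - 1ℤ) * h)) - a
                     ≡ a * (+ 2 * h + 1ℤ) * (+ 2 * h - 1ℤ)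
  identity = solve-∀

⟨1,-2⟩-represents : ∀ {a} → ¬ a ≡ 0ℤ mod + 3 → Represents₂ 3 1ℤ (- + 2) a
⟨1,-2⟩-represents {a} a≢0 with residue 3 a
... | 0 , _ , a≡0 = ⊥-elim (a≢0 a≡0)
... | 1 , _ , a≡1 = Represents₁⇒Represents₂ 0ℤ (hensel₃ (≡mod-sym (begin
  a - - + 2 * (0ℤ * 0ℤ) ≡⟨ solve (a ∷ []) ⟩
  a                     ≈⟨ a≡1 ⟩
  1ℤ                    ∎)))
  where open ≡mod-Reasoning (+ 3)
... | 2 , _ , a≡2 = Represents₁⇒Represents₂ 1ℤ (hensel₃ (≡mod-sym (begin
  a - - + 2 * (1ℤ * 1ℤ) ≡⟨ solve (a ∷ []) ⟩
  a + + 2               ≈⟨ +-≡mod a≡2 ≡mod-refl ⟩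
  + 4                   ≈⟨ congruent (divides 1ℤ refl) ⟩
  1ℤ                    ∎)))
  where open ≡mod-Reasoning (+ 3)
... | suc (suc (suc _)) , s≤s (s≤s (s≤s ())) , _

ThreeStable⇒represents : ∀ b → ThreeStable b → ∀ a → ¬ a ≡ 0ℤ mod + 3 → Represents 3 b a
ThreeStable⇒represents b (inj₁ K⊇⟨1,-1⟩) a _ =
  RepresentsBinary⇒Represents {b = b} K⊇⟨1,-1⟩ (hyperbolic-represents a)
ThreeStable⇒represents b (inj₂ (_ , _ , e , _ , diagonal)) a a≢0 =
  RepresentsBinary⇒Represents {b = b} K⊇⟨1,-Δ₃⟩ (⟨1,-2⟩-represents a≢0)
  where
  K⊇⟨1,-Δ₃⟩ : RepresentsBinary 3 b 1ℤ (- Δ₃)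
  K⊇⟨1,-Δ₃⟩ = e zero , e (suc zero) , λ k → let Q₀ , Q₁ , _ , B₀₁ , _ = diagonal k in Q₀ , Q₁ , B₀₁

-- Choice of ν

module ResidueChoice (u l r : ℤ) where
  x : ℕ → ℤ
  x ν = u * + ν + l

  x-step : ∀ i j → x (i ℕ.+ j) - x i ≡ + j * u
  x-step i j = begin
    u * + (i ℕ.+ j) + l - (u * + i + l)  ≡⟨ cong (λ i+j → u * i+j + l - (u * + i + l)) (pos-+ i j) ⟩
    u * (+ i + + j) + l - (u * + i + l)  ≡⟨ identity u l (+ i) (+ j) ⟩
    + j * u                              ∎
    where
    open ≡-Reasoning
    identity : ∀ u l i j → u * (i + j) + l - (u * i + l) ≡ j * u
    identity = solve-∀

  x-distinct : ∀ {m} i j → ¬ m ∣ˢ + j * u → ¬ x (i ℕ.+ j) ≡ x i mod m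
  x-distinct i j m∤ju (congruent m∣) = m∤ju (m∣ ∣-by x-step i j)

  module _ (2∤u : ¬ + 2 ∣ˢ u) where
    4∤1u : ¬ + 4 ∣ˢ + 1 * u
    4∤1u 4∣u = 2∤u (∣-trans (divides (+ 2) refl) (4∣u ∣-by *-identityˡ u))

    4∤2u : ¬ + 4 ∣ˢ + 2 * u
    4∤2u 4∣2u = 2∤u (*-cancelˡ-∣ (+ 2) 4∣2u)

    4∤3u : ¬ + 4 ∣ˢ + 3 * u
    4∤3u 4∣3u = 4∤1u (∣-from-consecutive-multiples (+ 3) u (∣m⇒∣m*n u ∣-refl) 4∣3u ∣-by sym (*-identityˡ u))

    choose-ν₄ : Σ ℕ λ ν → ν ≤ 2 × ¬ x ν ≡ 0ℤ ∨ r mod + 4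
    choose-ν₄ with avoid-two-classes 0ℤ r (x-distinct 0 1 4∤1u) (x-distinct 0 2 4∤2u) (x-distinct 1 1 4∤1u)
    ... | inj₁ x₀∉        = 0 , z≤n , x₀∉
    ... | inj₂ (inj₁ x₁∉) = 1 , s≤s z≤n , x₁∉
    ... | inj₂ (inj₂ x₂∉) = 2 , s≤s (s≤s z≤n) , x₂∉

    module _ (3∤u : ¬ + 3 ∣ˢ u) where
      3∤1u : ¬ + 3 ∣ˢ + 1 * u
      3∤1u 3∣u = 3∤u (3∣u ∣-by *-identityˡ u)

      3∤2u : ¬ + 3 ∣ˢ + 2 * u
      3∤2u 3∣2u = 3∤u (∣-from-consecutive-multiples (+ 2) u (∣m⇒∣m*n u ∣-refl) 3∣2u)

      3∤4u : ¬ + 3 ∣ˢ + 4 * u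
      3∤4u 3∣4u = 3∤u (∣-from-consecutive-multiples (+ 3) u 3∣4u (∣m⇒∣m*n u ∣-refl))

      x-nonzero-after : ∀ {i} → x i ≡ 0ℤ mod + 3 → ∀ j → ¬ + 3 ∣ˢ + j * u → ¬ x (i ℕ.+ j) ≡ 0ℤ mod + 3
      x-nonzero-after {i} xᵢ≡0 j 3∤ju xᵢ₊ⱼ≡0 = x-distinct i j 3∤ju (≡mod-trans xᵢ₊ⱼ≡0 (≡mod-sym xᵢ≡0))

      Candidate : ℕ → Set
      Candidate ν = ν ≤ 4 × ¬ x ν ≡ 0ℤ mod + 3

      from-triple : ∀ {i j k} → Candidate i → Candidate j → Candidate k →
        ¬ x j ≡ x i mod + 4 → ¬ x k ≡ x i mod + 4 → ¬ x k ≡ x j mod + 4 →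
        Σ ℕ λ ν → ν ≤ 4 × ¬ x ν ≡ 0ℤ ∨ r mod + 4 × ¬ x ν ≡ 0ℤ mod + 3
      from-triple {i} {j} {k} (i≤4 , 3∤xᵢ) (j≤4 , 3∤xⱼ) (k≤4 , 3∤xₖ) xⱼ≢xᵢ xₖ≢xᵢ xₖ≢xⱼ
        with avoid-two-classes 0ℤ r xⱼ≢xᵢ xₖ≢xᵢ xₖ≢xⱼ
      ... | inj₁ xᵢ∉        = i , i≤4 , xᵢ∉ , 3∤xᵢ
      ... | inj₂ (inj₁ xⱼ∉) = j , j≤4 , xⱼ∉ , 3∤xⱼ
      ... | inj₂ (inj₂ xₖ∉) = k , k≤4 , xₖ∉ , 3∤xₖ

      1≤4 : 1 ≤ 4
      1≤4 = s≤s z≤n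
      2≤4 : 2 ≤ 4
      2≤4 = s≤s (s≤s z≤n)
      3≤4 : 3 ≤ 4
      3≤4 = s≤s (s≤s (s≤s z≤n))

      -- The triple is {1,2,4}, {0,2,3} or {0,1,3}, according as 3 divides x 0, x 1 or neither.
      choose-ν₁₂ : Σ ℕ λ ν → ν ≤ 4 × ¬ x ν ≡ 0ℤ ∨ r mod + 4 × ¬ x ν ≡ 0ℤ mod + 3
      choose-ν₁₂ with ≡mod? (x 0) 0ℤ | ≡mod? (x 1) 0ℤ
      ... | yes x₀≡0 | _ =
        from-triple (1≤4 , x-nonzero-after x₀≡0 1 3∤1u) (2≤4 , x-nonzero-after x₀≡0 2 3∤2u)
                    (ℕ.≤-refl , x-nonzero-after x₀≡0 4 3∤4u)
                    (x-distinct 1 1 4∤1u) (x-distinct 1 3 4∤3u) (x-distinct 2 2 4∤2u)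
      ... | no x₀≢0 | yes x₁≡0 =
        from-triple (z≤n , x₀≢0) (2≤4 , x-nonzero-after x₁≡0 1 3∤1u) (3≤4 , x-nonzero-after x₁≡0 2 3∤2u)
                    (x-distinct 0 2 4∤2u) (x-distinct 0 3 4∤3u) (x-distinct 2 1 4∤1u)
      ... | no x₀≢0 | no x₁≢0 =
        from-triple (z≤n , x₀≢0) (1≤4 , x₁≢0) (3≤4 , x₀≢0 ∘ ≡mod-trans (≡mod-sym x₃≡x₀))
                    (x-distinct 0 1 4∤1u) (x-distinct 0 3 4∤3u) (x-distinct 1 2 4∤2u)
        where
        x₃≡x₀ : x 3 ≡ x 0 mod + 3
        x₃≡x₀ = congruent (∣m⇒∣m*n u ∣-refl ∣-by sym (x-step 0 3))

progression-≡ : ∀ N u n ν l → u * (+ N * n + + ν) + l ≡ u * + ν + l mod + N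
progression-≡ N u n ν l = congruent (divides (u * n) (identity u n (+ ν) l (+ N)))
  where
  identity : ∀ u n ν l N → u * (N * n + ν) + l - (u * ν + l) ≡ u * n * N
  identity = solve-∀

gcd[u,6]≡1⇒3∤u : ∀ {u} → gcd u (+ 6) ≡ + 1 → ¬ + 3 ∣ˢ u
gcd[u,6]≡1⇒3∤u {u} gcd≡1 3∣u
  with ℕ.∣1⇒≡1 (subst (+ 3 ∣_) gcd≡1 (gcd-greatest {u} {+ 6} {+ 3} (∣⇒∣ᵤ 3∣u) (ℕ.divides 2 refl)))
... | ()

lemma2p3 : (b : Fin 3 → ℤ) → (∀ i → 0ℤ < b i) → TwoStable b →
    (u l : ℤ) → ¬ ((+ 2) ∣ u) →
    (Σ ℕ λ ν → (ν ≤ 2) × (∀ (n : ℤ) → Represents 2 b (u * ((+ 4) * n + (+ ν)) + l)))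
    × (ThreeStable b → gcd u (+ 6) ≡ + 1 →
       Σ ℕ λ ν → (ν ≤ 4) × (∀ (n : ℤ) →
         Represents 2 b (u * ((+ 12) * n + (+ ν)) + l)
         × Represents 3 b (u * ((+ 12) * n + (+ ν)) + l)))
lemma2p3 b _ K₂-stable u l 2∤u with TwoStable⇒represents b K₂-stable
  -- positivity of the coefficients plays no role in these local statements
... | r , K₂-represents =
  (let ν , ν≤2 , xν∉ = choose-ν₄ 2∤ˢu in
   ν , ν≤2 , λ n → K₂-represents _ (∉-classes-resp (progression-≡ 4 u n ν l) xν∉))
  , λ K₃-stable gcd≡1 →
    let ν , ν≤4 , xν∉ , 3∤xν = choose-ν₁₂ 2∤ˢu (gcd[u,6]≡1⇒3∤u gcd≡1)
        a≡xν[4] = λ n → ≡mod-divisor (divides (+ 3) refl) (progression-≡ 12 u n ν l)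
        a≡xν[3] = λ n → ≡mod-divisor (divides (+ 4) refl) (progression-≡ 12 u n ν l)
    in ν , ν≤4 , λ n → K₂-represents _ (∉-classes-resp (a≡xν[4] n) xν∉)
                     , ThreeStable⇒represents b K₃-stable _ (3∤xν ∘ ≡mod-trans (≡mod-sym (a≡xν[3] n)))
  where
  open ResidueChoice u l r
  2∤ˢu : ¬ + 2 ∣ˢ u
  2∤ˢu = 2∤u ∘ ∣⇒∣ᵤ
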